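{- Let $p^G\colon G\to\mathsf{fc}(\Sigma)$ and $p^H\colon H\to\mathsf{fc}(\Sigma)$ be graphs with testing, $x$ a vertex of $G$ and $y$ a vertex of $H$. If $x\sim_{\mathsf{fc}(\Sigma)}y$, then $x\in\bot^G$ if and only if $y\in\bot^H$.
   Context: All graphs are reflexive (each vertex has an identity edge, preserved by morphisms). Convention: we write $x\xleftarrow{a}y$ if there is an edge $e\colon y\to x$ with $p(e)=a$, and $x\leftarrow y$ if $a$ is the identity. $\Sigma$ is the reflexive graph with one vertex and endo-edges $\tau$ (the identity) and $\heartsuit$; $\mathsf{fc}(\Sigma)$ is its free category viewed as a reflexive graph: one vertex, edges $\heartsuit^k$ for $k\ge0$, $\heartsuit^0$ the identity. Strong bisimilarity $\sim_{\mathsf{fc}(\Sigma)}$ between vertices of graphs over $\mathsf{fc}(\Sigma)$ is the largest relation $S$ such that if $x\,S\,y$ and $x\xleftarrow{a}x'$ then $y\xleftarrow{a}y'$ with $x'\,S\,y'$, and symmetrically. A graph with testing is a graph $G$ with $p\colon G\to\mathsf{fc}(\Sigma)$ and a relation $(\mathrm{ob}(G))^2\to\mathrm{ob}(G)$ whose domain is an equivalence relation and which is partially functional up to $\sim_{\mathsf{fc}(\Sigma)}$. $\bot^G$ is the set of vertices $x$ of $G$ such that for every $x\leftarrow x'$ there exists $x'\xleftarrow{\heartsuit}x''$ (an edge over $\heartsuit=\heartsuit^1$). -}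

module Defs where

open import Data.Nat using (ℕ; zero; suc)
open import Data.Product using (Σ; ∃; _×_; _,_)
open import Relation.Binary.PropositionalEquality using (_≡_)

-- Reflexive graph over fc(Σ).  fc(Σ) has one vertex and edges ♡^k (k : ℕ),
-- ♡^0 being the identity; so a morphism p : G → fc(Σ) is a labelling of the
-- edges of G by natural numbers k (standing for ♡^k) sending identities to 0.
record GraphOverFcΣ : Set₁ where
  field
    V     : Set
    E     : V → V → Set
    idE   : (x : V) → E x x
    lab   : {s t : V} → E s t → ℕ
    lab-id : (x : V) → lab (idE x) ≡ 0

open GraphOverFcΣ public

_∋_←[_]_ : (G : GraphOverFcΣ) → V G → ℕ → V G → Set
G ∋ x ←[ a ] y = Σ (E G y x) λ e → lab G e ≡ a

_∋_←_ : (G : GraphOverFcΣ) → V G → V G → Set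
G ∋ x ← y = G ∋ x ←[ 0 ] y

♡ : ℕ
♡ = 1

IsBisimulation : (G H : GraphOverFcΣ) → (V G → V H → Set) → Set
IsBisimulation G H S =
  (∀ {x y} → S x y → ∀ {a x'} → G ∋ x ←[ a ] x' →
     Σ (V H) λ y' → (H ∋ y ←[ a ] y') × S x' y')
  × (∀ {x y} → S x y → ∀ {a y'} → H ∋ y ←[ a ] y' →
     Σ (V G) λ x' → (G ∋ x ←[ a ] x') × S x' y')

-- strong bisimilarity ∼_{fc(Σ)}: the largest bisimulation, i.e. the union
-- of all bisimulations
_∣_∋_∼_ : (G H : GraphOverFcΣ) → V G → V H → Set₁
G ∣ H ∋ x ∼ y = Σ (V G → V H → Set) λ S → IsBisimulation G H S × S x y

record GraphWithTesting : Set₁ where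
  field
    graph : GraphOverFcΣ
  open GraphOverFcΣ graph renaming (V to Vg)
  field
    test : Vg → Vg → Vg → Set
  Dom : Vg → Vg → Set
  Dom x y = Σ Vg λ z → test x y z
  field
    dom-refl  : ∀ x → Dom x x
    dom-sym   : ∀ {x y} → Dom x y → Dom y x
    dom-trans : ∀ {x y z} → Dom x y → Dom y z → Dom x z
    test-func : ∀ {x y z z'} → test x y z → test x y z' →
                graph ∣ graph ∋ z ∼ z'

open GraphWithTesting public

⊥[_] : (G : GraphOverFcΣ) → V G → Set
⊥[ G ] x = ∀ x' → G ∋ x ← x' → Σ (V G) λ x'' → G ∋ x' ←[ ♡ ] x''

module Submission where

-- The set ⊥^G is defined purely in terms of the labelled edges of G
-- ("every identity-labelled predecessor x' of x has a ♡-labelled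
-- predecessor"), so it is invariant under any strong bisimulation.
--
-- A 0-edge into y is matched by a 0-edge into
--     x (backward clause), ⊥^G gives a ♡-edge at the matched vertex, and the
--     forward clause carries that ♡-edge back to H.
--   * `converse-bisimulation`: the converse of a bisimulation is one, which
--     gives the reverse implication from the same lemma.
--   * `lemma2p23` combines both directions for bisimilar vertices.

open import Defs
open import Function.Bundles using (_⇔_; mk⇔)
open import Data.Product using (_,_)

converse-bisimulation : (G H : GraphOverFcΣ) (S : V G → V H → Set) →
  IsBisimulation G H S → IsBisimulation H G (λ y x → S x y)
converse-bisimulation G H S (forth , back) = back , forth

⊥-transfer : (G H : GraphOverFcΣ) (S : V G → V H → Set) →
  IsBisimulation G H S → ∀ {x y} → S x y → ⊥[ G ] x → ⊥[ H ] y
⊥-transfer G H S (forth , back) sxy x∈⊥ y' y←y' with back sxy y←y'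
... | x' , x←x' , sx'y' with x∈⊥ x' x←x'
... | x'' , x'←♡x'' with forth sx'y' x'←♡x''
... | y'' , y'←♡y'' , _ = y'' , y'←♡y''

lemma2p23 : (G H : GraphWithTesting) (x : V (graph G)) (y : V (graph H)) →
    graph G ∣ graph H ∋ x ∼ y → (⊥[ graph G ] x ⇔ ⊥[ graph H ] y)
lemma2p23 G H x y (S , S-bisim , sxy) =
  mk⇔ (⊥-transfer G′ H′ S S-bisim sxy)
      (⊥-transfer H′ G′ (λ y x → S x y) (converse-bisimulation G′ H′ S S-bisim) sxy)
  where
  G′ H′ : GraphOverFcΣ
  G′ = graph G
  H′ = graph H
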